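{- Suppose $[\gamma]\in J(K)$ generates an $\mathbb{F}_2[G]$-submodule isomorphic to $\mathbb{F}_2[\overline{G_i}]$ for some $i\in\{1,2,3\}$. Then $T(\langle[\gamma]\rangle^G)=\{(1,1,1)\}$.
   Context: $F$ is a field with $\operatorname{char}(F)\ne2$, $K=F(\sqrt{a_1},\sqrt{a_2})$ Galois over $F$ with $G=\operatorname{Gal}(K/F)\simeq\mathbb{Z}/2\oplus\mathbb{Z}/2$ generated by $\sigma_1,\sigma_2$ with $\sigma_i(\sqrt{a_j})=(-1)^{\delta_{ij}}\sqrt{a_j}$; $K_1=F(\sqrt{a_1})$, $K_2=F(\sqrt{a_2})$, $K_3=F(\sqrt{a_1a_2})$. $\overline{G_1}=G/\langle\sigma_2\rangle$, $\overline{G_2}=G/\langle\sigma_1\rangle$, $\overline{G_3}=G/\langle\sigma_1\sigma_2\rangle$, with $\mathbb{F}_2[\overline{G_i}]$ an $\mathbb{F}_2[G]$-module via the quotient. $J(K)=K^\times/K^{\times2}$; $\langle[\gamma]\rangle$ is the $\mathbb{F}_2[G]$-submodule generated by $[\gamma]$ and $\langle[\gamma]\rangle^G$ its fixed part. $T:J(K)^G\to\bigoplus_{i=1}^3(K_i^\times\cap K^{\times2})/K_i^{\times2}$ is $T([\gamma])=([N_{K/K_1}(\gamma)]_1,[N_{K/K_2}(\gamma)]_2,[N_{K/K_3}(\gamma)]_3)$, where $[x]_i$ is the class of $x$ in $(K_i^\times\cap K^{\times2})/K_i^{\times2}$; $(1,1,1)$ denotes the trivial value. -}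

module Defs where

open import Level using (Level; _⊔_)
open import Data.Bool using (Bool; true; false; _xor_)
open import Data.Product using (Σ; ∃; _×_; _,_)
open import Relation.Nullary using (¬_)
open import Relation.Binary.PropositionalEquality using (_≡_)
open import Algebra.Bundles using (CommutativeRing)
open import Algebra.Morphism.Structures using (IsRingHomomorphism)

data G : Set where
  e s₁ s₂ s₁₂ : G

_·G_ : G → G → G
e   ·G h   = h
g   ·G e   = g
s₁  ·G s₁  = e
s₁  ·G s₂  = s₁₂
s₁  ·G s₁₂ = s₂
s₂  ·G s₁  = s₁₂
s₂  ·G s₂  = e
s₂  ·G s₁₂ = s₁
s₁₂ ·G s₁  = s₂
s₁₂ ·G s₂  = s₁
s₁₂ ·G s₁₂ = e

data Idx : Set where
  one two three : Idx

-- the generator of the subgroup H_i with Ḡ_i = G / H_i :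
-- H₁ = ⟨σ₂⟩, H₂ = ⟨σ₁⟩, H₃ = ⟨σ₁σ₂⟩
hgen : Idx → G
hgen one   = s₂
hgen two   = s₁
hgen three = s₁₂

inH : Idx → G → Bool
inH i e   = true
inH one   s₂  = true
inH two   s₁  = true
inH three s₁₂ = true
inH _     _   = false

F2G : Set
F2G = G → Bool

-- left regular action of g on 𝔽₂[G] : (g·λ)(h) = λ(g⁻¹h) = λ(g h)
actF2G : G → F2G → F2G
actF2G g l h = l (g ·G h)

addF2G : F2G → F2G → F2G
addF2G l m h = l h xor m h

-- 𝔽₂[Ḡ_i] (Ḡ_i ≅ ℤ/2) : pair (coefficient of the trivial coset,
-- coefficient of the nontrivial coset); G acts through the quotient
-- G → Ḡ_i, i.e. g swaps the two cosets iff g ∉ H_i.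
F2Gbar : Set
F2Gbar = Bool × Bool

actF2Gbar : Idx → G → F2Gbar → F2Gbar
actF2Gbar i g (a , b) with inH i g
... | true  = (a , b)
... | false = (b , a)

addF2Gbar : F2Gbar → F2Gbar → F2Gbar
addF2Gbar (a , b) (c , d) = (a xor c , b xor d)

-- A biquadratic Galois extension K = F(√a₁, √a₂) / F, char ≠ 2.
-- K is a field (commutative ring with 1 ≉ 0 and inverses of nonzero
-- elements); G acts by ring automorphisms σ₁, σ₂; F is the fixed field
-- of G; r₁, r₂ are square roots of a₁, a₂ ∈ F with σᵢ(rⱼ) = (-1)^δᵢⱼ rⱼ,
-- and K is generated over F by r₁, r₂.

record BiquadraticExtension (c ℓ : Level) : Set (Level.suc (c ⊔ ℓ)) where
  field
    Kring : CommutativeRing c ℓ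
  open CommutativeRing Kring public
  field
    1≉0      : ¬ (1# ≈ 0#)
    inverse  : ∀ x → ¬ (x ≈ 0#) → ∃ λ y → x * y ≈ 1#
    char≠2   : ¬ (1# + 1# ≈ 0#)
    σ₁ σ₂    : Carrier → Carrier
    σ₁-hom   : IsRingHomomorphism rawRing rawRing σ₁
    σ₂-hom   : IsRingHomomorphism rawRing rawRing σ₂
    σ₁-invol : ∀ x → σ₁ (σ₁ x) ≈ x
    σ₂-invol : ∀ x → σ₂ (σ₂ x) ≈ x
    σ-comm   : ∀ x → σ₁ (σ₂ x) ≈ σ₂ (σ₁ x)
    r₁ r₂    : Carrier
    r₁≉0     : ¬ (r₁ ≈ 0#)
    r₂≉0     : ¬ (r₂ ≈ 0#)
    σ₁r₁     : σ₁ r₁ ≈ - r₁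
    σ₁r₂     : σ₁ r₂ ≈ r₂
    σ₂r₁     : σ₂ r₁ ≈ r₁
    σ₂r₂     : σ₂ r₂ ≈ - r₂

  InF : Carrier → Set ℓ
  InF x = (σ₁ x ≈ x) × (σ₂ x ≈ x)

  field
    generated : ∀ x → Σ (Carrier × Carrier × Carrier × Carrier) λ where
      (c₀ , c₁ , c₂ , c₃) → InF c₀ × InF c₁ × InF c₂ × InF c₃ ×
                            (x ≈ c₀ + c₁ * r₁ + c₂ * r₂ + c₃ * (r₁ * r₂))

  -- a₁, a₂ ∈ F (r₁² and r₂² are G-fixed by the σ-rules above)
  a₁ a₂ : Carrier
  a₁ = r₁ * r₁
  a₂ = r₂ * r₂

  act : G → Carrier → Carrier
  act e   x = x
  act s₁  x = σ₁ x
  act s₂  x = σ₂ x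
  act s₁₂ x = σ₁ (σ₂ x)

  -- the intermediate fields K_i = K^{H_i}:
  -- K₁ = F(√a₁) = K^⟨σ₂⟩, K₂ = F(√a₂) = K^⟨σ₁⟩, K₃ = F(√(a₁a₂)) = K^⟨σ₁σ₂⟩
  InK : Idx → Carrier → Set ℓ
  InK i x = act (hgen i) x ≈ x

  -- N_{K/K_i}(x) = x · τ(x), τ the generator of Gal(K/K_i) = H_i
  N : Idx → Carrier → Carrier
  N i x = x * act (hgen i) x

  -- J(K) = K^×/K^{×2}: two nonzero elements have the same class iff
  -- their quotient is a square of a nonzero element
  _∼_ : Carrier → Carrier → Set (c ⊔ ℓ)
  x ∼ y = ∃ λ z → ¬ (z ≈ 0#) × (x ≈ y * (z * z))

  -- x is a square of an element of K_i (class trivial in K_i^×/K_i^{×2})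
  SquareIn : Idx → Carrier → Set (c ⊔ ℓ)
  SquareIn i x = ∃ λ y → InK i y × (x ≈ y * y)

  -- the 𝔽₂[G]-module action on J(K) (written multiplicatively):
  -- λ·[γ] = [∏_{g : λ(g) = 1} g(γ)]
  _⊙_ : F2G → Carrier → Carrier
  l ⊙ γ = f e * (f s₁ * (f s₂ * f s₁₂))
    where
    f : G → Carrier
    f g with l g
    ... | true  = act g γ
    ... | false = 1#

  -- Elements of the submodule ⟨[γ]⟩ are the classes [λ ⊙ γ], λ ∈ 𝔽₂[G].
  -- ⟨[γ]⟩ ≅ 𝔽₂[Ḡ_i] as 𝔽₂[G]-modules: a map φ from representatives λ,
  -- well defined on classes, additive, G-equivariant, injective on
  -- classes and surjective.
  record SubmoduleIso (γ : Carrier) (i : Idx) : Set (c ⊔ ℓ) where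
    field
      φ          : F2G → F2Gbar
      φ-wd       : ∀ l m → (l ⊙ γ) ∼ (m ⊙ γ) → φ l ≡ φ m
      φ-add      : ∀ l m → φ (addF2G l m) ≡ addF2Gbar (φ l) (φ m)
      φ-equiv    : ∀ g l → φ (actF2G g l) ≡ actF2Gbar i g (φ l)
      φ-inj      : ∀ l m → φ l ≡ φ m → (l ⊙ γ) ∼ (m ⊙ γ)
      φ-surj     : ∀ v → ∃ λ u → φ u ≡ v

  FixedClass : Carrier → Set (c ⊔ ℓ)
  FixedClass δ = ∀ g → act g δ ∼ δ

module Submission where

-- A G-fixed class in ⟨[γ]⟩ ≅ 𝔽₂[Ḡᵢ] is 0 or the norm element 1 + ḡ.  In the first case
-- the representative is a square.  In the second, with [β] the preimage of 1, the
-- representative is β · g β modulo squares for every g ∉ Hᵢ.  For j ≠ i take g = τⱼ: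
-- the norm to Kⱼ of β · τⱼ β ∈ Kⱼ is its square.  For j = i the class [β] is τᵢ-fixed,
-- and the witness is built from τᵢ β ≈ β c².

open import Defs
open import Data.Bool using (Bool; true; false; _xor_; _∧_)
open import Data.Bool.Properties using (xor-same)
open import Data.Product using (∃; _×_; _,_)
open import Data.Sum using (_⊎_; inj₁; inj₂)
open import Relation.Nullary using (¬_)
open import Relation.Binary.PropositionalEquality as ≡ using (_≡_)
open import Algebra.Morphism.Structures using (IsRingHomomorphism)
import Algebra.Morphism.Construct.Identity as Identity
import Algebra.Morphism.Construct.Composition as Composition
import Algebra.Properties.Ring as RingProperties
import Algebra.Solver.CommutativeMonoid as CommutativeMonoidSolver
import Relation.Binary.Reasoning.Setoid as SetoidReasoning

·G-self : ∀ g → g ·G g ≡ e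
·G-self e   = ≡.refl
·G-self s₁  = ≡.refl
·G-self s₂  = ≡.refl
·G-self s₁₂ = ≡.refl

·G-comm : ∀ g h → g ·G h ≡ h ·G g
·G-comm e   e   = ≡.refl
·G-comm e   s₁  = ≡.refl
·G-comm e   s₂  = ≡.refl
·G-comm e   s₁₂ = ≡.refl
·G-comm s₁  e   = ≡.refl
·G-comm s₁  s₁  = ≡.refl
·G-comm s₁  s₂  = ≡.refl
·G-comm s₁  s₁₂ = ≡.refl
·G-comm s₂  e   = ≡.refl
·G-comm s₂  s₁  = ≡.refl
·G-comm s₂  s₂  = ≡.refl
·G-comm s₂  s₁₂ = ≡.refl
·G-comm s₁₂ e   = ≡.refl
·G-comm s₁₂ s₁  = ≡.refl
·G-comm s₁₂ s₂  = ≡.refl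
·G-comm s₁₂ s₁₂ = ≡.refl

hgen-∈ : ∀ i → inH i (hgen i) ≡ true
hgen-∈ one   = ≡.refl
hgen-∈ two   = ≡.refl
hgen-∈ three = ≡.refl

hgen-∉ : ∀ i j → i ≡ j ⊎ inH i (hgen j) ≡ false
hgen-∉ one   one   = inj₁ ≡.refl
hgen-∉ one   two   = inj₂ ≡.refl
hgen-∉ one   three = inj₂ ≡.refl
hgen-∉ two   one   = inj₂ ≡.refl
hgen-∉ two   two   = inj₁ ≡.refl
hgen-∉ two   three = inj₂ ≡.refl
hgen-∉ three one   = inj₂ ≡.refl
hgen-∉ three two   = inj₂ ≡.refl
hgen-∉ three three = inj₁ ≡.refl

outside : Idx → G
outside one   = s₁
outside two   = s₂
outside three = s₁

outside-∉ : ∀ i → inH i (outside i) ≡ false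
outside-∉ one   = ≡.refl
outside-∉ two   = ≡.refl
outside-∉ three = ≡.refl

actF2Gbar-∈ : ∀ i {g} → inH i g ≡ true → ∀ v → actF2Gbar i g v ≡ v
actF2Gbar-∈ i g∈ (a , b) rewrite g∈ = ≡.refl

actF2Gbar-∉ : ∀ i {g} → inH i g ≡ false → ∀ a b → actF2Gbar i g (a , b) ≡ (b , a)
actF2Gbar-∉ i g∉ a b rewrite g∉ = ≡.refl

addF2Gbar-self : ∀ v → addF2Gbar v v ≡ (false , false)
addF2Gbar-self (a , b) = ≡.cong₂ _,_ (xor-same a) (xor-same b)

actF2Gbar-fixed : ∀ i {g} → inH i g ≡ false → ∀ v → actF2Gbar i g v ≡ v →
                  v ≡ (false , false) ⊎ v ≡ (true , true)
actF2Gbar-fixed i g∉ (a , b) fixed = swap-fixed a b (≡.trans (≡.sym (actF2Gbar-∉ i g∉ a b)) fixed)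
  where
  swap-fixed : ∀ a b → (b , a) ≡ (a , b) → (a , b) ≡ (false , false) ⊎ (a , b) ≡ (true , true)
  swap-fixed false false _ = inj₁ ≡.refl
  swap-fixed true  true  _ = inj₂ ≡.refl
  swap-fixed false true  ()
  swap-fixed true  false ()

module Biquadratic {c ℓ} (E : BiquadraticExtension c ℓ) where
  open BiquadraticExtension E
  open RingProperties ring using (+-inverseˡ-unique; -‿+-comm; -‿injective; -0#≈0#)
  open CommutativeMonoidSolver *-commutativeMonoid using (solve; _⊜_; _⊕_)
  open SetoidReasoning setoid

  act-isRingHomomorphism : ∀ g → IsRingHomomorphism rawRing rawRing (act g)
  act-isRingHomomorphism e   = Identity.isRingHomomorphism rawRing refl
  act-isRingHomomorphism s₁  = σ₁-hom
  act-isRingHomomorphism s₂  = σ₂-hom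
  act-isRingHomomorphism s₁₂ = Composition.isRingHomomorphism trans σ₂-hom σ₁-hom

  module _ (g : G) where
    open IsRingHomomorphism (act-isRingHomomorphism g)

    act-cong : ∀ {x y} → x ≈ y → act g x ≈ act g y
    act-cong = ⟦⟧-cong

    act-* : ∀ x y → act g (x * y) ≈ act g x * act g y
    act-* = *-homo

    act-1 : act g 1# ≈ 1#
    act-1 = 1#-homo

    act-0 : act g 0# ≈ 0#
    act-0 = 0#-homo

    act-‿ : ∀ x → act g (- x) ≈ - act g x
    act-‿ = -‿homo

  act-∘ : ∀ g h x → act g (act h x) ≈ act (g ·G h) x
  act-∘ e   h   x = refl
  act-∘ s₁  e   x = refl
  act-∘ s₁  s₁  x = σ₁-invol x
  act-∘ s₁  s₂  x = refl
  act-∘ s₁  s₁₂ x = σ₁-invol (σ₂ x)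
  act-∘ s₂  e   x = refl
  act-∘ s₂  s₁  x = sym (σ-comm x)
  act-∘ s₂  s₂  x = σ₂-invol x
  act-∘ s₂  s₁₂ x = trans (sym (σ-comm (σ₂ x))) (act-cong s₁ (σ₂-invol x))
  act-∘ s₁₂ e   x = refl
  act-∘ s₁₂ s₁  x = trans (act-cong s₁ (sym (σ-comm x))) (σ₁-invol (σ₂ x))
  act-∘ s₁₂ s₂  x = act-cong s₁ (σ₂-invol x)
  act-∘ s₁₂ s₁₂ x = trans (act-cong s₁ (sym (σ-comm (σ₂ x)))) (trans (σ₁-invol _) (σ₂-invol x))

  act-invol : ∀ g x → act g (act g x) ≈ x
  act-invol g x = trans (act-∘ g g x) (≡.subst (λ h → act h x ≈ x) (≡.sym (·G-self g)) refl)

  act-swap : ∀ g h x → act g (act h x) ≈ act h (act g x)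
  act-swap g h x = begin
    act g (act h x) ≈⟨ act-∘ g h x ⟩
    act (g ·G h) x  ≡⟨ ≡.cong (λ k → act k x) (·G-comm g h) ⟩
    act (h ·G g) x  ≈⟨ act-∘ h g x ⟨
    act h (act g x) ∎

  *-cancelˡ : ∀ {a b d} → ¬ (a ≈ 0#) → a * b ≈ a * d → b ≈ d
  *-cancelˡ {a} {b} {d} a≉0 ab≈ad with inverse a a≉0
  ... | a⁻¹ , aa⁻¹≈1 = begin
    b              ≈⟨ *-identityˡ b ⟨
    1# * b         ≈⟨ *-congʳ (trans (sym aa⁻¹≈1) (*-comm a a⁻¹)) ⟩
    (a⁻¹ * a) * b  ≈⟨ *-assoc a⁻¹ a b ⟩
    a⁻¹ * (a * b)  ≈⟨ *-congˡ ab≈ad ⟩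
    a⁻¹ * (a * d)  ≈⟨ *-assoc a⁻¹ a d ⟨
    (a⁻¹ * a) * d  ≈⟨ *-congʳ (trans (*-comm a⁻¹ a) aa⁻¹≈1) ⟩
    1# * d         ≈⟨ *-identityˡ d ⟩
    d              ∎

  *≈0⇒≈0 : ∀ {a b} → ¬ (a ≈ 0#) → a * b ≈ 0# → b ≈ 0#
  *≈0⇒≈0 {a} a≉0 ab≈0 = *-cancelˡ a≉0 (trans ab≈0 (sym (zeroʳ a)))

  *-≉0 : ∀ {a b} → ¬ (a ≈ 0#) → ¬ (b ≈ 0#) → ¬ (a * b ≈ 0#)
  *-≉0 a≉0 b≉0 ab≈0 = b≉0 (*≈0⇒≈0 a≉0 ab≈0)

  act-≉0 : ∀ g {x} → ¬ (x ≈ 0#) → ¬ (act g x ≈ 0#)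
  act-≉0 g {x} x≉0 gx≈0 = x≉0 (trans (sym (act-invol g x)) (trans (act-cong g gx≈0) (act-0 g)))

  -- Cancel y + g y, which is nonzero since char ≠ 2: if y + g y ≈ 0, then both
  -- y ≈ 1 and y ≈ -1 would give 1 + 1 ≈ 0.
  square≈1⇒act-fixed : ∀ g y → y * y ≈ 1# → act g y ≈ y
  square≈1⇒act-fixed g y y²≈1 = *-cancelˡ sum≉0 (begin
    (y + gy) * gy     ≈⟨ distribʳ gy y gy ⟩
    y * gy + gy * gy  ≈⟨ +-cong (*-comm y gy) gy²≈1 ⟩
    gy * y + 1#       ≈⟨ +-comm (gy * y) 1# ⟩
    1# + gy * y       ≈⟨ +-congʳ y²≈1 ⟨
    y * y + gy * y    ≈⟨ distribʳ y y gy ⟨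
    (y + gy) * y      ∎)
    where
    gy : Carrier
    gy = act g y
    gy²≈1 : gy * gy ≈ 1#
    gy²≈1 = trans (sym (act-* g y y)) (trans (act-cong g y²≈1) (act-1 g))
    ≉-1⇒≈1 : ¬ (y + 1# ≈ 0#) → y ≈ 1#
    ≉-1⇒≈1 y+1≉0 = *-cancelˡ y+1≉0 (begin
      (y + 1#) * y        ≈⟨ distribʳ y y 1# ⟩
      y * y + 1# * y      ≈⟨ +-cong y²≈1 (*-identityˡ y) ⟩
      1# + y              ≈⟨ +-comm 1# y ⟩
      y + 1#              ≈⟨ *-identityʳ (y + 1#) ⟨
      (y + 1#) * 1#       ∎)
    sum≉0 : ¬ (y + gy ≈ 0#)
    sum≉0 sum≈0 = char≠2 (y≈1⇒2≈0 (≉-1⇒≈1 (λ y+1≈0 → char≠2 (y+1≈0⇒2≈0 y+1≈0))))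
      where
      y≈1⇒2≈0 : y ≈ 1# → 1# + 1# ≈ 0#
      y≈1⇒2≈0 y≈1 = trans (+-cong (sym y≈1) (sym (trans (act-cong g y≈1) (act-1 g)))) sum≈0
      y+1≈0⇒2≈0 : y + 1# ≈ 0# → 1# + 1# ≈ 0#
      y+1≈0⇒2≈0 y+1≈0 = -‿injective (trans (sym (-‿+-comm 1# 1#)) (trans minus-ones≈0 (sym -0#≈0#)))
        where
        y≈-1 : y ≈ - 1#
        y≈-1 = +-inverseˡ-unique y 1# y+1≈0
        minus-ones≈0 : - 1# + - 1# ≈ 0#
        minus-ones≈0 = trans (+-cong (sym y≈-1) (sym (trans (act-cong g y≈-1) (trans (act-‿ g 1#) (-‿cong (act-1 g)))))) sum≈0

  ∼-resp : ∀ {x x′ y y′} → x ≈ x′ → y ≈ y′ → x ∼ y → x′ ∼ y′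
  ∼-resp x≈x′ y≈y′ (z , z≉0 , x≈yz²) = z , z≉0 , trans (sym x≈x′) (trans x≈yz² (*-congʳ y≈y′))

  ∼-trans : ∀ {x y w} → x ∼ y → y ∼ w → x ∼ w
  ∼-trans {x} {y} {w} (z , z≉0 , x≈yz²) (z′ , z′≉0 , y≈wz′²) = z′ * z , *-≉0 z′≉0 z≉0 , (begin
    x                          ≈⟨ x≈yz² ⟩
    y * (z * z)                ≈⟨ *-congʳ y≈wz′² ⟩
    (w * (z′ * z′)) * (z * z)  ≈⟨ solve 3 (λ w z′ z → (w ⊕ (z′ ⊕ z′)) ⊕ (z ⊕ z) ⊜ w ⊕ ((z′ ⊕ z) ⊕ (z′ ⊕ z))) refl w z′ z ⟩
    w * ((z′ * z) * (z′ * z))  ∎)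

  ∼-sym : ∀ {x y} → x ∼ y → y ∼ x
  ∼-sym {x} {y} (z , z≉0 , x≈yz²) with inverse z z≉0
  ... | z⁻¹ , zz⁻¹≈1 = z⁻¹ , (λ z⁻¹≈0 → 1≉0 (trans (sym zz⁻¹≈1) (trans (*-congˡ z⁻¹≈0) (zeroʳ z)))) , (begin
    y                                ≈⟨ *-identityʳ y ⟨
    y * 1#                           ≈⟨ *-congˡ (*-identityʳ 1#) ⟨
    y * (1# * 1#)                    ≈⟨ *-congˡ (*-cong zz⁻¹≈1 zz⁻¹≈1) ⟨
    y * ((z * z⁻¹) * (z * z⁻¹))      ≈⟨ solve 3 (λ y z z⁻¹ → y ⊕ ((z ⊕ z⁻¹) ⊕ (z ⊕ z⁻¹)) ⊜ (y ⊕ (z ⊕ z)) ⊕ (z⁻¹ ⊕ z⁻¹)) refl y z z⁻¹ ⟩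
    (y * (z * z)) * (z⁻¹ * z⁻¹)      ≈⟨ *-congʳ x≈yz² ⟨
    x * (z⁻¹ * z⁻¹)                  ∎)

  ∏G : (G → Carrier) → Carrier
  ∏G f = f e * (f s₁ * (f s₂ * f s₁₂))

  ∏G-cong : ∀ {f h} → (∀ g → f g ≈ h g) → ∏G f ≈ ∏G h
  ∏G-cong f≈h = *-cong (f≈h e) (*-cong (f≈h s₁) (*-cong (f≈h s₂) (f≈h s₁₂)))

  ∏G-* : ∀ f h → ∏G f * ∏G h ≈ ∏G (λ g → f g * h g)
  ∏G-* f h = solve 8 (λ a b c d a′ b′ c′ d′ →
    (a ⊕ (b ⊕ (c ⊕ d))) ⊕ (a′ ⊕ (b′ ⊕ (c′ ⊕ d′))) ⊜ (a ⊕ a′) ⊕ ((b ⊕ b′) ⊕ ((c ⊕ c′) ⊕ (d ⊕ d′))))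
    refl (f e) (f s₁) (f s₂) (f s₁₂) (h e) (h s₁) (h s₂) (h s₁₂)

  ∏G-1 : ∏G (λ _ → 1#) ≈ 1#
  ∏G-1 = trans (*-identityˡ _) (trans (*-identityˡ _) (*-identityˡ 1#))

  ∏G-≉0 : ∀ f → (∀ g → ¬ (f g ≈ 0#)) → ¬ (∏G f ≈ 0#)
  ∏G-≉0 f f≉0 = *-≉0 (f≉0 e) (*-≉0 (f≉0 s₁) (*-≉0 (f≉0 s₂) (f≉0 s₁₂)))

  ∏G-reindex : ∀ g f → ∏G (λ h → f (g ·G h)) ≈ ∏G f
  ∏G-reindex e   f = refl
  ∏G-reindex s₁  f = solve 4 (λ a b c d → b ⊕ (a ⊕ (d ⊕ c)) ⊜ a ⊕ (b ⊕ (c ⊕ d))) refl (f e) (f s₁) (f s₂) (f s₁₂)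
  ∏G-reindex s₂  f = solve 4 (λ a b c d → c ⊕ (d ⊕ (a ⊕ b)) ⊜ a ⊕ (b ⊕ (c ⊕ d))) refl (f e) (f s₁) (f s₂) (f s₁₂)
  ∏G-reindex s₁₂ f = solve 4 (λ a b c d → d ⊕ (c ⊕ (b ⊕ a)) ⊜ a ⊕ (b ⊕ (c ⊕ d))) refl (f e) (f s₁) (f s₂) (f s₁₂)

  act-∏G : ∀ g f → act g (∏G f) ≈ ∏G (λ h → act g (f h))
  act-∏G g f = trans (act-* g _ _) (*-congˡ (trans (act-* g _ _) (*-congˡ (act-* g _ _))))

  infix 8 _^ᵇ_
  _^ᵇ_ : Carrier → Bool → Carrier
  x ^ᵇ true  = x
  x ^ᵇ false = 1#

  ^ᵇ-cong : ∀ b {x y} → x ≈ y → x ^ᵇ b ≈ y ^ᵇ b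
  ^ᵇ-cong true  x≈y = x≈y
  ^ᵇ-cong false _   = refl

  act-^ᵇ : ∀ g x b → act g (x ^ᵇ b) ≈ act g x ^ᵇ b
  act-^ᵇ g x true  = refl
  act-^ᵇ g x false = act-1 g

  ^ᵇ-≉0 : ∀ b {x} → ¬ (x ≈ 0#) → ¬ (x ^ᵇ b ≈ 0#)
  ^ᵇ-≉0 true  x≉0 = x≉0
  ^ᵇ-≉0 false _   = 1≉0

  ^ᵇ-xor : ∀ x a b → x ^ᵇ a * x ^ᵇ b ≈ x ^ᵇ (a xor b) * (x ^ᵇ (a ∧ b) * x ^ᵇ (a ∧ b))
  ^ᵇ-xor x true  true  = sym (*-identityˡ (x * x))
  ^ᵇ-xor x true  false = *-congˡ (sym (*-identityʳ 1#))
  ^ᵇ-xor x false true  = trans (*-comm 1# x) (*-congˡ (sym (*-identityʳ 1#)))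
  ^ᵇ-xor x false false = *-congˡ (sym (*-identityʳ 1#))

  ⊙-∏G : ∀ l x → l ⊙ x ≡ ∏G (λ g → act g x ^ᵇ l g)
  ⊙-∏G l x with l e | l s₁ | l s₂ | l s₁₂
  ... | true  | true  | true  | true  = ≡.refl
  ... | true  | true  | true  | false = ≡.refl
  ... | true  | true  | false | true  = ≡.refl
  ... | true  | true  | false | false = ≡.refl
  ... | true  | false | true  | true  = ≡.refl
  ... | true  | false | true  | false = ≡.refl
  ... | true  | false | false | true  = ≡.refl
  ... | true  | false | false | false = ≡.refl
  ... | false | true  | true  | true  = ≡.refl
  ... | false | true  | true  | false = ≡.refl
  ... | false | true  | false | true  = ≡.refl
  ... | false | true  | false | false = ≡.refl
  ... | false | false | true  | true  = ≡.refl
  ... | false | false | true  | false = ≡.refl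
  ... | false | false | false | true  = ≡.refl
  ... | false | false | false | false = ≡.refl

  ⊙-≉0 : ∀ l {x} → ¬ (x ≈ 0#) → ¬ (l ⊙ x ≈ 0#)
  ⊙-≉0 l {x} x≉0 rewrite ⊙-∏G l x = ∏G-≉0 _ (λ g → ^ᵇ-≉0 (l g) (act-≉0 g x≉0))

  ⊙-zero : ∀ x → (λ _ → false) ⊙ x ≈ 1#
  ⊙-zero x = ∏G-1

  ⊙-equivariant : ∀ g l x → act g (l ⊙ x) ≈ actF2G g l ⊙ x
  ⊙-equivariant g l x = begin
    act g (l ⊙ x)                                     ≡⟨ ≡.cong (act g) (⊙-∏G l x) ⟩
    act g (∏G (λ h → act h x ^ᵇ l h))                 ≈⟨ act-∏G g (λ h → act h x ^ᵇ l h) ⟩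
    ∏G (λ h → act g (act h x ^ᵇ l h))                 ≈⟨ ∏G-cong (λ h → trans (act-^ᵇ g _ (l h)) (^ᵇ-cong (l h) (act-∘ g h x))) ⟩
    ∏G (λ h → act (g ·G h) x ^ᵇ l h)                  ≈⟨ ∏G-reindex g (λ h → act (g ·G h) x ^ᵇ l h) ⟨
    ∏G (λ h → act (g ·G (g ·G h)) x ^ᵇ l (g ·G h))    ≈⟨ ∏G-cong (λ h → ^ᵇ-cong (l (g ·G h)) (act-twice h)) ⟩
    ∏G (λ h → act h x ^ᵇ l (g ·G h))                  ≡⟨ ≡.sym (⊙-∏G (actF2G g l) x) ⟩
    actF2G g l ⊙ x                                    ∎
    where
    act-twice : ∀ h → act (g ·G (g ·G h)) x ≈ act h x
    act-twice h = begin
      act (g ·G (g ·G h)) x    ≈⟨ act-∘ g (g ·G h) x ⟨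
      act g (act (g ·G h) x)   ≈⟨ act-cong g (act-∘ g h x) ⟨
      act g (act g (act h x))  ≈⟨ act-invol g (act h x) ⟩
      act h x                  ∎

  ⊙-additive : ∀ l m x → ¬ (x ≈ 0#) → (addF2G l m ⊙ x) ∼ ((l ⊙ x) * (m ⊙ x))
  ⊙-additive l m x x≉0 = ∼-sym (n ⊙ x , ⊙-≉0 n x≉0 , (begin
    (l ⊙ x) * (m ⊙ x)                                         ≡⟨ ≡.cong₂ _*_ (⊙-∏G l x) (⊙-∏G m x) ⟩
    ∏G (λ g → y g ^ᵇ l g) * ∏G (λ g → y g ^ᵇ m g)             ≈⟨ ∏G-* (λ g → y g ^ᵇ l g) (λ g → y g ^ᵇ m g) ⟩
    ∏G (λ g → y g ^ᵇ l g * y g ^ᵇ m g)                        ≈⟨ ∏G-cong (λ g → ^ᵇ-xor (y g) (l g) (m g)) ⟩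
    ∏G (λ g → y g ^ᵇ (l g xor m g) * (y g ^ᵇ n g * y g ^ᵇ n g)) ≈⟨ ∏G-* (λ g → y g ^ᵇ (l g xor m g)) (λ g → y g ^ᵇ n g * y g ^ᵇ n g) ⟨
    ∏G (λ g → y g ^ᵇ (l g xor m g)) * ∏G (λ g → y g ^ᵇ n g * y g ^ᵇ n g) ≈⟨ *-congˡ (∏G-* (λ g → y g ^ᵇ n g) (λ g → y g ^ᵇ n g)) ⟨
    ∏G (λ g → y g ^ᵇ (l g xor m g)) * (∏G (λ g → y g ^ᵇ n g) * ∏G (λ g → y g ^ᵇ n g))
      ≡⟨ ≡.cong₂ (λ a b → a * (b * b)) (≡.sym (⊙-∏G (addF2G l m) x)) (≡.sym (⊙-∏G n x)) ⟩
    addF2G l m ⊙ x * (n ⊙ x * n ⊙ x)                          ∎))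
    where
    y : G → Carrier
    y g = act g x
    n : F2G
    n g = l g ∧ m g

  module _ (j : Idx) where
    private
      τ : G
      τ = hgen j

    InK-* : ∀ {a b} → InK j a → InK j b → InK j (a * b)
    InK-* {a} {b} τa≈a τb≈b = trans (act-* τ a b) (*-cong τa≈a τb≈b)

    N-InK : ∀ z → InK j (N j z)
    N-InK z = trans (act-* τ z (act τ z)) (trans (*-congˡ (act-invol τ z)) (*-comm (act τ z) z))

    N-cong : ∀ {x y} → x ≈ y → N j x ≈ N j y
    N-cong x≈y = *-cong x≈y (act-cong τ x≈y)

    N-* : ∀ a b → N j (a * b) ≈ N j a * N j b
    N-* a b = trans (*-congˡ (act-* τ a b))
      (solve 4 (λ a b τa τb → (a ⊕ b) ⊕ (τa ⊕ τb) ⊜ (a ⊕ τa) ⊕ (b ⊕ τb)) refl a b (act τ a) (act τ b))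

    InK⇒SquareIn-N : ∀ {x} → InK j x → SquareIn j (N j x)
    InK⇒SquareIn-N {x} τx≈x = x , τx≈x , *-congˡ τx≈x

    SquareIn-N-resp-∼ : ∀ {δ w} → δ ∼ w → SquareIn j (N j w) → SquareIn j (N j δ)
    SquareIn-N-resp-∼ {δ} {w} (z , _ , δ≈wz²) (y , y∈Kⱼ , Nw≈y²) = y * N j z , InK-* y∈Kⱼ (N-InK z) , (begin
      N j δ                            ≈⟨ N-cong δ≈wz² ⟩
      N j (w * (z * z))                ≈⟨ trans (N-* w (z * z)) (*-congˡ (N-* z z)) ⟩
      N j w * (N j z * N j z)          ≈⟨ *-congʳ Nw≈y² ⟩
      (y * y) * (N j z * N j z)        ≈⟨ solve 2 (λ y n → (y ⊕ y) ⊕ (n ⊕ n) ⊜ (y ⊕ n) ⊕ (y ⊕ n)) refl y (N j z) ⟩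
      (y * N j z) * (y * N j z)        ∎)

    -- With τβ ≈ β c², the witness is β · gβ · c · gc; it lies in Kⱼ because
    -- N c is a square root of 1, hence fixed by g.
    τ-fixedClass⇒SquareIn-N : ∀ g {β} → ¬ (β ≈ 0#) → act τ β ∼ β → SquareIn j (N j (β * act g β))
    τ-fixedClass⇒SquareIn-N g {β} β≉0 (c , _ , τβ≈βc²) = w * u , τ[wu]≈wu , (begin
      N j w                    ≈⟨ *-congˡ τw≈wu² ⟩
      w * (w * (u * u))        ≈⟨ solve 2 (λ w u → w ⊕ (w ⊕ (u ⊕ u)) ⊜ (w ⊕ u) ⊕ (w ⊕ u)) refl w u ⟩
      (w * u) * (w * u)        ∎)
      where
      w u : Carrier
      w = β * act g β
      u = c * act g c

      N[c]²≈1 : N j c * N j c ≈ 1#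
      N[c]²≈1 = sym (*-cancelˡ β≉0 (begin
        β * 1#                             ≈⟨ *-identityʳ β ⟩
        β                                  ≈⟨ act-invol τ β ⟨
        act τ (act τ β)                    ≈⟨ act-cong τ τβ≈βc² ⟩
        act τ (β * (c * c))                ≈⟨ trans (act-* τ β (c * c)) (*-congˡ (act-* τ c c)) ⟩
        act τ β * (act τ c * act τ c)      ≈⟨ *-congʳ τβ≈βc² ⟩
        (β * (c * c)) * (act τ c * act τ c) ≈⟨ solve 3 (λ β c τc → (β ⊕ (c ⊕ c)) ⊕ (τc ⊕ τc) ⊜ β ⊕ ((c ⊕ τc) ⊕ (c ⊕ τc))) refl β c (act τ c) ⟩
        β * (N j c * N j c)                ∎))

      τgβ≈gβ[gc]² : act τ (act g β) ≈ act g β * (act g c * act g c)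
      τgβ≈gβ[gc]² = begin
        act τ (act g β)                  ≈⟨ act-swap τ g β ⟩
        act g (act τ β)                  ≈⟨ act-cong g τβ≈βc² ⟩
        act g (β * (c * c))              ≈⟨ trans (act-* g β (c * c)) (*-congˡ (act-* g c c)) ⟩
        act g β * (act g c * act g c)    ∎

      τw≈wu² : act τ w ≈ w * (u * u)
      τw≈wu² = begin
        act τ w                                               ≈⟨ act-* τ β (act g β) ⟩
        act τ β * act τ (act g β)                             ≈⟨ *-cong τβ≈βc² τgβ≈gβ[gc]² ⟩
        (β * (c * c)) * (act g β * (act g c * act g c))
          ≈⟨ solve 4 (λ β gβ c gc → (β ⊕ (c ⊕ c)) ⊕ (gβ ⊕ (gc ⊕ gc)) ⊜ (β ⊕ gβ) ⊕ ((c ⊕ gc) ⊕ (c ⊕ gc))) refl β (act g β) c (act g c) ⟩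
        w * (u * u)                                           ∎

      u·τu≈1 : u * act τ u ≈ 1#
      u·τu≈1 = begin
        u * act τ u                                      ≈⟨ *-congˡ (trans (act-* τ c (act g c)) (*-congˡ (act-swap τ g c))) ⟩
        (c * act g c) * (act τ c * act g (act τ c))
          ≈⟨ solve 4 (λ c gc τc gτc → (c ⊕ gc) ⊕ (τc ⊕ gτc) ⊜ (c ⊕ τc) ⊕ (gc ⊕ gτc)) refl c (act g c) (act τ c) (act g (act τ c)) ⟩
        N j c * (act g c * act g (act τ c))               ≈⟨ *-congˡ (act-* g c (act τ c)) ⟨
        N j c * act g (N j c)                            ≈⟨ *-congˡ (square≈1⇒act-fixed g (N j c) N[c]²≈1) ⟩
        N j c * N j c                                    ≈⟨ N[c]²≈1 ⟩
        1#                                               ∎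

      τ[wu]≈wu : act τ (w * u) ≈ w * u
      τ[wu]≈wu = begin
        act τ (w * u)            ≈⟨ act-* τ w u ⟩
        act τ w * act τ u        ≈⟨ *-congʳ τw≈wu² ⟩
        (w * (u * u)) * act τ u  ≈⟨ solve 3 (λ w u τu → (w ⊕ (u ⊕ u)) ⊕ τu ⊜ (w ⊕ u) ⊕ (u ⊕ τu)) refl w u (act τ u) ⟩
        (w * u) * (u * act τ u)  ≈⟨ *-congˡ u·τu≈1 ⟩
        (w * u) * 1#             ≈⟨ *-identityʳ (w * u) ⟩
        w * u                    ∎

  module NormsOfFixedClass (γ : Carrier) (γ≉0 : ¬ (γ ≈ 0#)) {i : Idx} (iso : SubmoduleIso γ i)
           (l : F2G) (fixed : FixedClass (l ⊙ γ)) where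
    open SubmoduleIso iso

    φ-zero : φ (λ _ → false) ≡ (false , false)
    φ-zero = ≡.trans (φ-add (λ _ → false) (λ _ → false)) (addF2Gbar-self (φ (λ _ → false)))

    φ-invariant : ∀ g → actF2Gbar i g (φ l) ≡ φ l
    φ-invariant g = ≡.trans (≡.sym (φ-equiv g l))
      (φ-wd (actF2G g l) l (∼-resp (⊙-equivariant g l γ) refl (fixed g)))

    φl≡0⇒N-square : φ l ≡ (false , false) → ∀ j → SquareIn j (N j (l ⊙ γ))
    φl≡0⇒N-square φl≡0 j = SquareIn-N-resp-∼ j
      (∼-resp refl (⊙-zero γ) (φ-inj l _ (≡.trans φl≡0 (≡.sym φ-zero))))
      (InK⇒SquareIn-N j (act-1 (hgen j)))

    module _ (φl≡1 : φ l ≡ (true , true)) (u : F2G) (φu≡1,0 : φ u ≡ (true , false)) where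
      private
        β : Carrier
        β = u ⊙ γ

      φ[u+gu]≡1,1 : ∀ {g} → inH i g ≡ false → φ (addF2G u (actF2G g u)) ≡ (true , true)
      φ[u+gu]≡1,1 {g} g∉ rewrite φ-add u (actF2G g u) | φ-equiv g u | φu≡1,0 | actF2Gbar-∉ i g∉ true false = ≡.refl

      l∼β·gβ : ∀ {g} → inH i g ≡ false → (l ⊙ γ) ∼ (β * act g β)
      l∼β·gβ {g} g∉ = ∼-trans (φ-inj l (addF2G u (actF2G g u)) (≡.trans φl≡1 (≡.sym (φ[u+gu]≡1,1 g∉))))
        (∼-resp refl (*-congˡ (sym (⊙-equivariant g u γ))) (⊙-additive u (actF2G g u) γ γ≉0))

      τβ∼β : act (hgen i) β ∼ β
      τβ∼β = ∼-resp (sym (⊙-equivariant (hgen i) u γ)) refl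
        (φ-inj (actF2G (hgen i) u) u (≡.trans (φ-equiv (hgen i) u) (actF2Gbar-∈ i (hgen-∈ i) (φ u))))

      φl≡1⇒N-square : ∀ j → SquareIn j (N j (l ⊙ γ))
      φl≡1⇒N-square j with hgen-∉ i j
      ... | inj₁ ≡.refl = SquareIn-N-resp-∼ j (l∼β·gβ (outside-∉ i))
                            (τ-fixedClass⇒SquareIn-N j (outside i) (⊙-≉0 u γ≉0) τβ∼β)
      ... | inj₂ τⱼ∉ = SquareIn-N-resp-∼ j (l∼β·gβ τⱼ∉) (InK⇒SquareIn-N j (N-InK j β))

    N-square : ∀ j → SquareIn j (N j (l ⊙ γ))
    N-square with actF2Gbar-fixed i (outside-∉ i) (φ l) (φ-invariant (outside i)) | φ-surj (true , false)
    ... | inj₁ φl≡0 | _            = φl≡0⇒N-square φl≡0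
    ... | inj₂ φl≡1 | u , φu≡1,0   = φl≡1⇒N-square φl≡1 u φu≡1,0

corollary4p4 : ∀ {c ℓ} (E : BiquadraticExtension c ℓ) →
    let open BiquadraticExtension E in
    ∀ (γ : Carrier) → ¬ (γ ≈ 0#) → (∃ λ i → SubmoduleIso γ i) →
    ∀ (l : F2G) → FixedClass (l ⊙ γ) →
    SquareIn one (N one (l ⊙ γ)) × SquareIn two (N two (l ⊙ γ)) ×
      SquareIn three (N three (l ⊙ γ))
corollary4p4 E γ γ≉0 (_ , iso) l fixed = N-square one , N-square two , N-square three
  where open Biquadratic.NormsOfFixedClass E γ γ≉0 iso l fixed
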